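{- Let $p$ be a prime with $p\equiv2\pmod3$. Then \begin{align*} \sum_{k=0}^{(p+1)/3}(6k-1)(18k^2-6k+1)\frac{(-1/3)^4_k}{k!^4}\equiv0\pmod{p^4}. \end{align*}
   Context: $(x)_0=1$, $(x)_k=x(x+1)\cdots(x+k-1)$ is the Pochhammer symbol and $(x)_k^4=((x)_k)^4$. The congruence of rational numbers whose denominators are prime to $p$ is understood in $\mathbb{Z}_p$ (equivalently, the numerator of the reduced sum is divisible by $p^4$). -}

module Defs where

open import Data.Nat as ℕ using (ℕ; zero; suc; _!)
open import Data.Nat.Properties using (m^n≢0; _!≢0)
open import Data.Integer as ℤ using (ℤ; +_; -[1+_])
open import Data.Rational as ℚ using (ℚ; _+_; _*_; _/_)

poch : ℚ → ℕ → ℚ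
poch x zero    = ℚ.1ℚ
poch x (suc k) = poch x k * (x + (+ k / 1))

pow4 : ℚ → ℚ
pow4 x = x * x * x * x

sumTo : ℕ → (ℕ → ℚ) → ℚ
sumTo zero    f = f 0
sumTo (suc n) f = sumTo n f + f (suc n)

minusThird : ℚ
minusThird = -[1+ 0 ] / 3

term : ℕ → ℚ
term k = ((+ (6 ℕ.* k) ℤ.- + 1) ℤ.* (+ (18 ℕ.* k ℕ.* k) ℤ.- + (6 ℕ.* k) ℤ.+ + 1) / 1)
         * (pow4 (poch minusThird k)
         * (+ 1 / ((k !) ℕ.^ 4)) {{m^n≢0 (k !) 4 {{k !≢0}}}})

{-# OPTIONS --safe #-}
-- The sum telescopes. From the identity (6k-1)(18k²-6k+1) = 81k⁴ - (3k-1)⁴ one gets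
-- that its partial sum up to n is -81 (-1/3)₍ₙ₊₁₎⁴ / n!⁴. For n = (p+1)/3 the last factor
-- n - 1/3 of the Pochhammer symbol is p/3, so the numerator carries p⁴, whereas the
-- denominator 3^(4(n+1)) n!⁴ is prime to p because p ≠ 3 and n < p.
module Submission where

open import Defs
open import Data.Nat using (ℕ; _+_; _/_; _%_; _^_)
open import Data.Nat.Divisibility using (_∣_)
open import Data.Nat.Primality using (Prime)
open import Relation.Binary.PropositionalEquality using (_≡_)
open import Data.Integer using (∣_∣)
open import Data.Rational using (ℚ; ↥_)

open import Data.Empty using (⊥-elim)
open import Data.Integer as ℤ using (ℤ; +_; -[1+_]; +[1+_])
import Data.Integer.Properties as ℤP
open import Data.Integer.Solver using (module +-*-Solver)
open import Data.Nat as ℕ using (zero; suc; _!; _<_)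
open import Data.Nat.Divisibility
  using (divides; _∣?_; 1∣_; ∣⇒≤; ∣-trans; m∣m*n; n∣m*n; ∣m⇒∣m*n; *-cancelˡ-∣; *-monoʳ-∣)
open import Data.Nat.DivMod using (m≡m%n+[m/n]*n; m*n/n≡m)
open import Data.Nat.Primality using (euclidsLemma; prime⇒nonTrivial)
import Data.Nat.Properties as ℕP
import Data.Rational as ℚ
import Data.Rational.Properties as ℚP
open import Data.Rational.Unnormalised using (mkℚᵘ; *≡*) renaming (_≃_ to _≃ᵘ_)
import Data.Rational.Unnormalised.Properties as ℚᵘP
open import Data.Sum using (inj₁; inj₂)
open import Relation.Binary.PropositionalEquality
  using (refl; sym; trans; cong; cong₂; subst; module ≡-Reasoning)
open import Relation.Nullary using (¬_)
open import Relation.Nullary.Decidable using (toWitnessFalse)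

open +-*-Solver using (solve; _:=_; _:+_; _:-_; _:*_; con)

data Positive : ℤ → Set where
  +[1+_]-pos : ∀ b → Positive +[1+ b ]

positive-* : ∀ {B D} → Positive B → Positive D → Positive (B ℤ.* D)
positive-* +[1+ b ]-pos +[1+ d ]-pos = +[1+ d ℕ.+ b ℕ.* suc d ]-pos

infix 4 _≈_÷_

-- q ≈ a ÷ B : the rational q equals a / B for a positive integer B; the fraction need not be reduced.
data _≈_÷_ (q : ℚ) (a : ℤ) : ℤ → Set where
  fraction : ∀ b → ℚ.toℚᵘ q ≃ᵘ mkℚᵘ a b → q ≈ a ÷ +[1+ b ]

/-≈÷ : ∀ i n .{{_ : ℕ.NonZero n}} → i ℚ./ n ≈ i ÷ + n
/-≈÷ i (suc n) = fraction n (ℚP.toℚᵘ-fromℚᵘ (mkℚᵘ i n))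

≈÷-* : ∀ {q r a c B D} → q ≈ a ÷ B → r ≈ c ÷ D → q ℚ.* r ≈ a ℤ.* c ÷ B ℤ.* D
≈÷-* {q} {r} (fraction b q≃) (fraction d r≃) =
  fraction (d ℕ.+ b ℕ.* suc d) (ℚᵘP.≃-trans (ℚP.toℚᵘ-homo-* q r) (ℚᵘP.*-cong q≃ r≃))

≈÷-+ : ∀ {q r a c B D} → q ≈ a ÷ B → r ≈ c ÷ D → q ℚ.+ r ≈ a ℤ.* D ℤ.+ c ℤ.* B ÷ B ℤ.* D
≈÷-+ {q} {r} (fraction b q≃) (fraction d r≃) =
  fraction (d ℕ.+ b ℕ.* suc d) (ℚᵘP.≃-trans (ℚP.toℚᵘ-homo-+ q r) (ℚᵘP.+-cong q≃ r≃))

≈÷-rescale : ∀ {q a B a′ B′} → q ≈ a ÷ B → Positive B′ → a ℤ.* B′ ≡ a′ ℤ.* B → q ≈ a′ ÷ B′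
≈÷-rescale (fraction b q≃) +[1+ b′ ]-pos eq = fraction b′ (ℚᵘP.≃-trans q≃ (*≡* eq))

≈÷-cong : ∀ {q a B a′ B′} → a ≡ a′ → B ≡ B′ → q ≈ a ÷ B → q ≈ a′ ÷ B′
≈÷-cong refl refl q≈ = q≈

≈÷⇒↥*≡*↧ : ∀ {q a B} → q ≈ a ÷ B → ↥ q ℤ.* B ≡ a ℤ.* ℚ.↧ q
≈÷⇒↥*≡*↧ {ℚ.mkℚ _ _ _} (fraction b (*≡* eq)) = eq

_⁴ : ℤ → ℤ
x ⁴ = x ℤ.* x ℤ.* x ℤ.* x

⁴-distrib-* : ∀ x y → (x ℤ.* y) ⁴ ≡ x ⁴ ℤ.* y ⁴
⁴-distrib-* = solve 2 (λ x y → (x :* y) :* (x :* y) :* (x :* y) :* (x :* y)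
                             := (x :* x :* x :* x) :* (y :* y :* y :* y)) refl

^4≡⁴ : ∀ x → x ℤ.^ 4 ≡ x ⁴
^4≡⁴ = solve 1 (λ x → x :* (x :* (x :* (x :* con (+ 1)))) := x :* x :* x :* x) refl

pos-^ : ∀ m n → + (m ℕ.^ n) ≡ (+ m) ℤ.^ n
pos-^ m zero    = refl
pos-^ m (suc n) = trans (ℤP.pos-* m (m ℕ.^ n)) (cong (+ m ℤ.*_) (pos-^ m n))

pos-^4 : ∀ m → + (m ℕ.^ 4) ≡ (+ m) ⁴
pos-^4 m = trans (pos-^ m 4) (^4≡⁴ (+ m))

≈÷-⁴ : ∀ {q a B} → q ≈ a ÷ B → pow4 q ≈ a ⁴ ÷ B ⁴
≈÷-⁴ q≈ = ≈÷-* (≈÷-* (≈÷-* q≈ q≈) q≈) q≈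

positive-⁴ : ∀ {B} → Positive B → Positive (B ⁴)
positive-⁴ B>0 = positive-* (positive-* (positive-* B>0 B>0) B>0) B>0

pochNum : ℕ → ℤ
pochNum zero    = + 1
pochNum (suc k) = pochNum k ℤ.* (+ 3 ℤ.* + k ℤ.- + 1)

positive-3^ : ∀ k → Positive ((+ 3) ℤ.^ k)
positive-3^ zero    = +[1+ 0 ]-pos
positive-3^ (suc k) = positive-* +[1+ 2 ]-pos (positive-3^ k)

positive-! : ∀ n → Positive (+ (n !))
positive-! zero    = +[1+ 0 ]-pos
positive-! (suc n) =
  subst Positive (sym (ℤP.pos-* (suc n) (n !))) (positive-* +[1+ n ]-pos (positive-! n))

poch-minusThird : ∀ k → poch minusThird k ≈ pochNum k ÷ (+ 3) ℤ.^ k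
poch-minusThird zero    = /-≈÷ (+ 1) 1
poch-minusThird (suc k) =
  ≈÷-rescale (≈÷-* (poch-minusThird k) (≈÷-+ (/-≈÷ -[1+ 0 ] 3) (/-≈÷ (+ k) 1)))
             (positive-3^ (suc k))
             (solve 3 (λ P E K → (P :* (con -[1+ 0 ] :* con (+ 1) :+ K :* con (+ 3))) :* (con (+ 3) :* E)
                              := (P :* (con (+ 3) :* K :- con (+ 1))) :* (E :* (con (+ 3) :* con (+ 1))))
                    refl (pochNum k) ((+ 3) ℤ.^ k) (+ k))

summandPolynomial : ℕ → ℤ
summandPolynomial k = (+ (6 ℕ.* k) ℤ.- + 1) ℤ.* (+ (18 ℕ.* k ℕ.* k) ℤ.- + (6 ℕ.* k) ℤ.+ + 1)

[6K-1][18K²-6K+1]≡81K⁴-[3K-1]⁴ :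
  ∀ K → (+ 6 ℤ.* K ℤ.- + 1) ℤ.* (+ 18 ℤ.* K ℤ.* K ℤ.- + 6 ℤ.* K ℤ.+ + 1) ≡ + 81 ℤ.* K ⁴ ℤ.- (+ 3 ℤ.* K ℤ.- + 1) ⁴
[6K-1][18K²-6K+1]≡81K⁴-[3K-1]⁴ = solve 1 (λ K →
  let 3K-1 = con (+ 3) :* K :- con (+ 1) in
  (con (+ 6) :* K :- con (+ 1)) :* (con (+ 18) :* K :* K :- con (+ 6) :* K :+ con (+ 1))
    := con (+ 81) :* (K :* K :* K :* K) :- 3K-1 :* 3K-1 :* 3K-1 :* 3K-1) refl

term-≈÷ : ∀ k → term k ≈ (+ 81 ℤ.* (+ k) ⁴ ℤ.- (+ 3 ℤ.* + k ℤ.- + 1) ⁴) ℤ.* pochNum k ⁴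
                      ÷ ((+ 3) ℤ.^ k) ⁴ ℤ.* (+ (k !)) ⁴
term-≈÷ k = ≈÷-cong numerator denominator
  (≈÷-* (/-≈÷ (summandPolynomial k) 1)
        (≈÷-* (≈÷-⁴ (poch-minusThird k)) (/-≈÷ (+ 1) ((k !) ℕ.^ 4) {{k!^4≢0}})))
  where
  k!^4≢0 : ℕ.NonZero ((k !) ℕ.^ 4)
  k!^4≢0 = ℕP.m^n≢0 (k !) 4 {{k ℕP.!≢0}}
  numerator : summandPolynomial k ℤ.* (pochNum k ⁴ ℤ.* + 1)
              ≡ (+ 81 ℤ.* (+ k) ⁴ ℤ.- (+ 3 ℤ.* + k ℤ.- + 1) ⁴) ℤ.* pochNum k ⁴
  numerator = cong₂ ℤ._*_
    (trans (cong₂ (λ a b → (a ℤ.- + 1) ℤ.* (b ℤ.- a ℤ.+ + 1)) (ℤP.pos-* 6 k)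
                  (trans (ℤP.pos-* (18 ℕ.* k) k) (cong (ℤ._* + k) (ℤP.pos-* 18 k))))
           ([6K-1][18K²-6K+1]≡81K⁴-[3K-1]⁴ (+ k)))
    (ℤP.*-identityʳ (pochNum k ⁴))
  denominator : + 1 ℤ.* (((+ 3) ℤ.^ k) ⁴ ℤ.* + ((k !) ℕ.^ 4)) ≡ ((+ 3) ℤ.^ k) ⁴ ℤ.* (+ (k !)) ⁴
  denominator = trans (ℤP.*-identityˡ _) (cong (((+ 3) ℤ.^ k) ⁴ ℤ.*_) (pos-^4 (k !)))

telescope-step : ∀ {S T} w {e m f} y → Positive e → Positive m → Positive f →
  S ≈ -[1+ 80 ] ℤ.* w ÷ e ℤ.* f →
  T ≈ (+ 81 ℤ.* m ℤ.- y) ℤ.* w ÷ e ℤ.* (m ℤ.* f) →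
  S ℚ.+ T ≈ -[1+ 80 ] ℤ.* (w ℤ.* y) ÷ + 81 ℤ.* e ℤ.* (m ℤ.* f)
telescope-step w {e} {m} {f} y e>0 m>0 f>0 S≈ T≈ =
  ≈÷-rescale (≈÷-+ S≈ T≈) (positive-* (positive-* +[1+ 80 ]-pos e>0) (positive-* m>0 f>0))
    (solve 5 (λ w e m f y →
       (con -[1+ 80 ] :* w :* (e :* (m :* f)) :+ (con (+ 81) :* m :- y) :* w :* (e :* f))
         :* (con (+ 81) :* e :* (m :* f))
       := con -[1+ 80 ] :* (w :* y) :* (e :* f :* (e :* (m :* f)))) refl w e m f y)

partialSum-≈÷ : ∀ n → sumTo n term
                      ≈ -[1+ 80 ] ℤ.* pochNum (suc n) ⁴ ÷ ((+ 3) ℤ.^ suc n) ⁴ ℤ.* (+ (n !)) ⁴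
partialSum-≈÷ zero    =
  ≈÷-rescale (term-≈÷ 0) (positive-* (positive-⁴ (positive-3^ 1)) (positive-⁴ (positive-! 0))) refl
partialSum-≈÷ (suc n) = ≈÷-cong numerator denominator
  (telescope-step (pochNum (suc n) ⁴) ((+ 3 ℤ.* + suc n ℤ.- + 1) ⁴)
    (positive-⁴ (positive-3^ (suc n))) (positive-⁴ +[1+ n ]-pos) (positive-⁴ (positive-! n))
    (partialSum-≈÷ n)
    (≈÷-cong refl (cong (((+ 3) ℤ.^ suc n) ⁴ ℤ.*_) factorial⁴) (term-≈÷ (suc n))))
  where
  factorial⁴ : (+ (suc n !)) ⁴ ≡ (+ suc n) ⁴ ℤ.* (+ (n !)) ⁴
  factorial⁴ = trans (cong _⁴ (ℤP.pos-* (suc n) (n !))) (⁴-distrib-* (+ suc n) (+ (n !)))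
  numerator : -[1+ 80 ] ℤ.* (pochNum (suc n) ⁴ ℤ.* (+ 3 ℤ.* + suc n ℤ.- + 1) ⁴)
              ≡ -[1+ 80 ] ℤ.* pochNum (suc (suc n)) ⁴
  numerator = cong (-[1+ 80 ] ℤ.*_) (sym (⁴-distrib-* (pochNum (suc n)) (+ 3 ℤ.* + suc n ℤ.- + 1)))
  denominator : + 81 ℤ.* ((+ 3) ℤ.^ suc n) ⁴ ℤ.* ((+ suc n) ⁴ ℤ.* (+ (n !)) ⁴)
                ≡ ((+ 3) ℤ.^ suc (suc n)) ⁴ ℤ.* (+ (suc n !)) ⁴
  denominator = cong₂ ℤ._*_ (sym (⁴-distrib-* (+ 3) (((+ 3) ℤ.^ suc n)))) (sym factorial⁴)

p^4∣∣a*[c*p]⁴∣ : ∀ a c p → p ^ 4 ∣ ∣ a ℤ.* (c ℤ.* + p) ⁴ ∣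
p^4∣∣a*[c*p]⁴∣ a c p = subst (p ^ 4 ∣_) (sym ∣a*[c*p]⁴∣≡∣a*c⁴∣*p^4) (n∣m*n ∣ a ℤ.* c ⁴ ∣)
  where
  open ≡-Reasoning
  ∣a*[c*p]⁴∣≡∣a*c⁴∣*p^4 : ∣ a ℤ.* (c ℤ.* + p) ⁴ ∣ ≡ ∣ a ℤ.* c ⁴ ∣ ℕ.* p ^ 4
  ∣a*[c*p]⁴∣≡∣a*c⁴∣*p^4 = begin
    ∣ a ℤ.* (c ℤ.* + p) ⁴ ∣      ≡⟨ cong (λ t → ∣ a ℤ.* t ∣) (⁴-distrib-* c (+ p)) ⟩
    ∣ a ℤ.* (c ⁴ ℤ.* (+ p) ⁴) ∣  ≡⟨ cong ∣_∣ (sym (ℤP.*-assoc a (c ⁴) ((+ p) ⁴))) ⟩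
    ∣ a ℤ.* c ⁴ ℤ.* (+ p) ⁴ ∣    ≡⟨ cong (λ t → ∣ a ℤ.* c ⁴ ℤ.* t ∣) (sym (pos-^4 p)) ⟩
    ∣ a ℤ.* c ⁴ ℤ.* + (p ^ 4) ∣  ≡⟨ ℤP.abs-* (a ℤ.* c ⁴) (+ (p ^ 4)) ⟩
    ∣ a ℤ.* c ⁴ ∣ ℕ.* p ^ 4      ∎

module _ {p : ℕ} (p-prime : Prime p) where

  private instance
    p≢0 : ℕ.NonZero p
    p≢0 = ℕ.nonTrivial⇒nonZero p {{prime⇒nonTrivial p-prime}}

  private
    1<p : 1 < p
    1<p = ℕ.nonTrivial⇒n>1 p {{prime⇒nonTrivial p-prime}}

  ∤-< : ∀ n .{{_ : ℕ.NonZero n}} → n < p → ¬ p ∣ n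
  ∤-< n n<p p∣n = ℕP.<⇒≱ n<p (∣⇒≤ p∣n)

  ∤-* : ∀ {m n} → ¬ p ∣ m → ¬ p ∣ n → ¬ p ∣ m ℕ.* n
  ∤-* {m} {n} p∤m p∤n p∣mn with euclidsLemma m n p-prime p∣mn
  ... | inj₁ p∣m = p∤m p∣m
  ... | inj₂ p∣n = p∤n p∣n

  ∤-∣*∣ : ∀ x y → ¬ p ∣ ∣ x ∣ → ¬ p ∣ ∣ y ∣ → ¬ p ∣ ∣ x ℤ.* y ∣
  ∤-∣*∣ x y p∤x p∤y = subst (λ n → ¬ p ∣ n) (sym (ℤP.abs-* x y)) (∤-* p∤x p∤y)

  ∤-∣⁴∣ : ∀ x → ¬ p ∣ ∣ x ∣ → ¬ p ∣ ∣ x ⁴ ∣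
  ∤-∣⁴∣ x p∤x = ∤-∣*∣ (x ℤ.* x ℤ.* x) x (∤-∣*∣ (x ℤ.* x) x (∤-∣*∣ x x p∤x p∤x) p∤x) p∤x

  ∤-∣3^∣ : ¬ p ∣ 3 → ∀ k → ¬ p ∣ ∣ (+ 3) ℤ.^ k ∣
  ∤-∣3^∣ p∤3 zero    = ∤-< 1 1<p
  ∤-∣3^∣ p∤3 (suc k) = ∤-∣*∣ (+ 3) ((+ 3) ℤ.^ k) p∤3 (∤-∣3^∣ p∤3 k)

  ∤-! : ∀ n → n < p → ¬ p ∣ n !
  ∤-! zero    _   = ∤-< 1 1<p
  ∤-! (suc n) n<p = ∤-* (∤-< (suc n) n<p) (∤-! n (ℕP.<-trans (ℕP.n<1+n n) n<p))

  ^-∣-cancelʳ : ∀ k {x b} → ¬ p ∣ b → p ^ k ∣ x ℕ.* b → p ^ k ∣ x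
  ^-∣-cancelʳ zero    {x} _ _ = 1∣ x
  ^-∣-cancelʳ (suc k) {x} {b} p∤b pᵏ⁺¹∣xb
    with euclidsLemma x b p-prime (∣-trans (m∣m*n (p ^ k)) pᵏ⁺¹∣xb)
  ... | inj₂ p∣b = ⊥-elim (p∤b p∣b)
  ... | inj₁ (divides y refl) =
    subst (p ^ suc k ∣_) (ℕP.*-comm p y) (*-monoʳ-∣ p (^-∣-cancelʳ k p∤b (*-cancelˡ-∣ p pᵏ⁺¹∣p*[y*b])))
    where
    pᵏ⁺¹∣p*[y*b] : p ^ suc k ∣ p ℕ.* (y ℕ.* b)
    pᵏ⁺¹∣p*[y*b] = subst (p ^ suc k ∣_) (trans (cong (ℕ._* b) (ℕP.*-comm y p)) (ℕP.*-assoc p y b)) pᵏ⁺¹∣xb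

  ↥-divisible : ∀ {q a B} k → q ≈ a ÷ B → ¬ p ∣ ∣ B ∣ → p ^ k ∣ ∣ a ∣ → p ^ k ∣ ∣ ↥ q ∣
  ↥-divisible {q} {a} {B} k q≈ p∤B pᵏ∣a =
    ^-∣-cancelʳ k p∤B (subst (p ^ k ∣_) cross-multiplied (∣m⇒∣m*n ∣ ℚ.↧ q ∣ pᵏ∣a))
    where
    cross-multiplied : ∣ a ∣ ℕ.* ∣ ℚ.↧ q ∣ ≡ ∣ ↥ q ∣ ℕ.* ∣ B ∣
    cross-multiplied = trans (sym (ℤP.abs-* a (ℚ.↧ q)))
                             (trans (cong ∣_∣ (sym (≈÷⇒↥*≡*↧ q≈))) (ℤP.abs-* (↥ q) B))

  ↥partialSum-divisible : ¬ p ∣ 3 → ∀ n → n < p → + 3 ℤ.* + n ℤ.- + 1 ≡ + p →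
                          p ^ 4 ∣ ∣ ↥ (sumTo n term) ∣
  ↥partialSum-divisible p∤3 n n<p 3n-1≡p =
    ↥-divisible 4 (partialSum-≈÷ n) denominator-coprime numerator-divisible
    where
    numerator-divisible : p ^ 4 ∣ ∣ -[1+ 80 ] ℤ.* pochNum (suc n) ⁴ ∣
    numerator-divisible = subst (λ t → p ^ 4 ∣ ∣ -[1+ 80 ] ℤ.* (pochNum n ℤ.* t) ⁴ ∣)
                                (sym 3n-1≡p) (p^4∣∣a*[c*p]⁴∣ -[1+ 80 ] (pochNum n) p)
    denominator-coprime : ¬ p ∣ ∣ ((+ 3) ℤ.^ suc n) ⁴ ℤ.* (+ (n !)) ⁴ ∣
    denominator-coprime = ∤-∣*∣ (((+ 3) ℤ.^ suc n) ⁴) ((+ (n !)) ⁴)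
      (∤-∣⁴∣ ((+ 3) ℤ.^ suc n) (∤-∣3^∣ p∤3 (suc n)))
      (∤-∣⁴∣ (+ (n !)) (∤-! n n<p))

%3≡2⇒∤3 : ∀ {p} → p % 3 ≡ 2 → ¬ p ∣ 3
%3≡2⇒∤3 {2}                         _ = toWitnessFalse {a? = 2 ∣? 3} _
%3≡2⇒∤3 {suc (suc (suc (suc _)))} _ p∣3 with ∣⇒≤ p∣3
... | ℕ.s≤s (ℕ.s≤s (ℕ.s≤s ()))

mainTheorem8 : (p : ℕ) → Prime p → p % 3 ≡ 2 →
    p ^ 4 ∣ ∣ ↥ (sumTo ((p + 1) / 3) term) ∣
mainTheorem8 p p-prime p%3≡2 =
  subst (λ n → p ^ 4 ∣ ∣ ↥ (sumTo n term) ∣) (sym [p+1]/3≡1+m)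
    (↥partialSum-divisible p-prime (%3≡2⇒∤3 p%3≡2) (suc m) 1+m<p 3[1+m]-1≡p)
  where
  m : ℕ
  m = p / 3
  p≡2+3m : p ≡ 2 + m ℕ.* 3
  p≡2+3m = trans (m≡m%n+[m/n]*n p 3) (cong (_+ m ℕ.* 3) p%3≡2)
  [p+1]/3≡1+m : (p + 1) / 3 ≡ suc m
  [p+1]/3≡1+m = trans (cong (λ n → (n + 1) / 3) p≡2+3m)
                      (trans (cong (_/ 3) (ℕP.+-comm (2 + m ℕ.* 3) 1)) (m*n/n≡m (suc m) 3))
  1+m<p : suc m < p
  1+m<p = subst (suc m <_) (sym p≡2+3m) (ℕ.s≤s (ℕ.s≤s (ℕP.m≤m*n m 3)))
  3[1+m]-1≡p : + 3 ℤ.* + suc m ℤ.- + 1 ≡ + p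
  3[1+m]-1≡p = begin
    + 3 ℤ.* + suc m ℤ.- + 1  ≡⟨ solve 1 (λ M → con (+ 3) :* (con (+ 1) :+ M) :- con (+ 1)
                                             := con (+ 2) :+ M :* con (+ 3)) refl (+ m) ⟩
    + 2 ℤ.+ + m ℤ.* + 3      ≡⟨ cong (ℤ._+_ (+ 2)) (sym (ℤP.pos-* m 3)) ⟩
    + (2 + m ℕ.* 3)          ≡⟨ cong +_ (sym p≡2+3m) ⟩
    + p                      ∎
    where open ≡-Reasoning
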